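{- Let $n,k,r$ be positive integers with $r\geq 2$ and $n\geq rk$. Then $\chi_c(\mathrm{IG}_{n,k}^{(r)})\geq n/k$.
   Context: Write $[n]=\{1,\ldots,n\}$ and view its elements as placed in clockwise order on a circle; a $k$-subset of $[n]$ is called a $k$-polygon. A $k$-polygon $P$ is $r$-stable if the cyclic distance (on $\mathbb{Z}/n\mathbb{Z}$) between any two distinct points of $P$ is at least $r$. Two $k$-polygons $P=\{p_1<\cdots<p_k\}$ and $Q=\{q_1<\cdots<q_k\}$ interlace if either $p_1<q_1<\cdots<p_k<q_k$ or $q_1<p_1<\cdots<q_k<p_k$. The graph $\mathrm{IG}_{n,k}^{(r)}$ has as vertices the $r$-stable $k$-polygons on $[n]$, adjacent iff they interlace. A circular coloring of size $a/b$ of $G=(V,E)$ is a map $\chi:V\to\mathbb{Z}/a\mathbb{Z}$ with $\chi(v_1)-\chi(v_2)\in\{\overline{b},\ldots,\overline{ -b}\}$ for every edge $v_1v_2$; $\chi_c(G)$ is the minimum $a/b$ admitting such a coloring. -}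

module Defs where

open import Data.Nat using (ℕ; zero; suc; _+_; _*_; _∸_; _≤_; _<_; NonZero)
open import Data.Nat.DivMod using (_%_)
open import Data.Fin using (Fin; toℕ; _<_)
open import Data.Vec using (Vec; lookup)
open import Data.Product using (_×_)

IsPolygon : (n k : ℕ) → Vec ℕ k → Set
IsPolygon n k p =
  ((i : Fin k) → 1 ≤ lookup p i × lookup p i ≤ n) ×
  ((i j : Fin k) → i Data.Fin.< j → lookup p i Data.Nat.< lookup p j)

-- cyclic distance on ℤ/nℤ between x ≤ y with x,y ∈ [n]
cycDist : ℕ → ℕ → ℕ → ℕ
cycDist n x y = Data.Nat._⊓_ (y ∸ x) (n ∸ (y ∸ x))

IsStable : (n r k : ℕ) → Vec ℕ k → Set
IsStable n r k p =
  (i j : Fin k) → i Data.Fin.< j → r ≤ cycDist n (lookup p i) (lookup p j)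

IsVertex : (n k r : ℕ) → Vec ℕ k → Set
IsVertex n k r p = IsPolygon n k p × IsStable n r k p

InterlaceDir : (k : ℕ) → Vec ℕ k → Vec ℕ k → Set
InterlaceDir k p q =
  ((i : Fin k) → lookup p i Data.Nat.< lookup q i) ×
  ((i j : Fin k) → suc (toℕ i) ≡ toℕ j → lookup q i Data.Nat.< lookup p j)
  where open import Relation.Binary.PropositionalEquality using (_≡_)

Interlace : (k : ℕ) → Vec ℕ k → Vec ℕ k → Set
Interlace k p q = InterlaceDir k p q ⊎ InterlaceDir k q p
  where open import Data.Sum using (_⊎_)

diffMod : (a : ℕ) .{{_ : NonZero a}} → Fin a → Fin a → ℕ
diffMod a x y = (a + toℕ x ∸ toℕ y) % a

-- χ is a circular coloring of size a/b of IG^{(r)}_{n,k}: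
-- for every edge v₁v₂, χ(v₁) - χ(v₂) ∈ {b̄, …, -b̄} = {b, …, a-b} mod a.
-- (χ is given on all vectors; only its values on vertices matter.)
IsCircularColoring : (n k r a b : ℕ) .{{_ : NonZero a}} → (Vec ℕ k → Fin a) → Set
IsCircularColoring n k r a b χ =
  (p q : Vec ℕ k) → IsVertex n k r p → IsVertex n k r q → Interlace k p q →
  b ≤ diffMod a (χ p) (χ q) × diffMod a (χ p) (χ q) ≤ a ∸ b

-- The rotations P_x (x < n) of the regular k-gon, with vertices 1 + ⌊(x + j n)/k⌋, are r-stable,
-- and P_x, P_y interlace as soon as x and y are at cyclic distance at least k in ℤ/nℤ: they span a
-- copy of the circular clique K_{n/k}. Let χ be a circular coloring of size a/b. For a color c,
-- the x whose color lies in the arc [c, c + b) of ℤ/aℤ are pairwise at cyclic distance less than k,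
-- and such a set has at most k elements: measured from its least element, its points lie within k
-- of that element on one side or the other, and no two of these positions coincide. Sending a pair
-- (x, β) with β < b to the arc at distance β below the color of x and to the position of x in that
-- arc is therefore injective, so n b ≤ a k.
module Submission where

open import Defs
open import Data.Nat using (ℕ; _*_; _≤_; NonZero)
open import Data.Fin using (Fin)
open import Data.Vec using (Vec)
open import Data.Nat using (zero; suc; _+_; _∸_; _<_; z≤n; s≤s; >-nonZero⁻¹)
open import Data.Nat.Properties
open import Data.Nat.DivMod
open import Data.Nat.Divisibility using (n∣m*n)
open import Data.Nat.Induction using (<-rec)
open import Data.Nat.Tactic.RingSolver using (solve; solve-∀)
open import Data.List using (_∷_; [])
open import Data.Fin using (toℕ; fromℕ<)
open import Data.Fin.Properties using (toℕ<n; toℕ-fromℕ<; toℕ-injective; fromℕ<-injective; *↔×; injective⇒≤)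
open import Data.Vec using (lookup; tabulate)
open import Data.Vec.Properties using (lookup∘tabulate)
open import Data.Product using (∃-syntax; _×_; _,_; proj₁; proj₂)
open import Data.Product.Properties using (,-injective)
open import Data.Sum using (_⊎_; inj₁; inj₂)
open import Data.Empty using (⊥-elim)
open import Function.Bundles using (mk↣; Injection)
open import Function.Construct.Composition using (_↣-∘_)
open import Function.Construct.Symmetry using (↔-sym)
open import Function.Properties.Inverse using (↔⇒↣)
open import Relation.Nullary using (¬_; yes; no)
open import Relation.Unary using (Decidable)
open import Relation.Binary.PropositionalEquality
open import Function.Definitions using (Injective)

[m+n*k]/k≡m/k+n : ∀ m n k .{{_ : NonZero k}} → (m + n * k) / k ≡ m / k + n
[m+n*k]/k≡m/k+n m n k = trans (+-distrib-/-∣ʳ m (n∣m*n n)) (cong (m / k +_) (m*n/n≡m n k))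

m+n*k≤o⇒m/k+n≤o/k : ∀ {m o} n k .{{_ : NonZero k}} → m + n * k ≤ o → m / k + n ≤ o / k
m+n*k≤o⇒m/k+n≤o/k {m} {o} n k le = subst (_≤ o / k) ([m+n*k]/k≡m/k+n m n k) (/-monoˡ-≤ k le)

m+k≤o⇒m/k<o/k : ∀ {m o} k .{{_ : NonZero k}} → m + k ≤ o → m / k < o / k
m+k≤o⇒m/k<o/k {m} {o} k le = subst (_≤ o / k) (+-comm (m / k) 1)
  (m+n*k≤o⇒m/k+n≤o/k 1 k (subst (λ t → m + t ≤ o) (sym (*-identityˡ k)) le))

m<n+n⇒m%n≡m⊎m%n+n≡m : ∀ {m} n .{{_ : NonZero n}} → m < n + n → m % n ≡ m ⊎ m % n + n ≡ m
m<n+n⇒m%n≡m⊎m%n+n≡m {m} n m<n+n with m <? n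
... | yes m<n = inj₁ (m<n⇒m%n≡m m<n)
... | no m≮n = inj₂ (begin
  m % n + n        ≡⟨ cong (_+ n) (sym (m≤n⇒[n∸m]%m≡n%m n≤m)) ⟩
  (m ∸ n) % n + n  ≡⟨ cong (_+ n) (m<n⇒m%n≡m (m<n+o⇒m∸n<o m n m<n+n)) ⟩
  m ∸ n + n        ≡⟨ m∸n+n≡m n≤m ⟩
  m                ∎)
  where
  open ≡-Reasoning
  n≤m : n ≤ m
  n≤m = ≮⇒≥ m≮n

Least : (ℕ → Set) → Set
Least P = ∃[ s ] P s × (∀ {y} → P y → s ≤ y)

least : ∀ {P : ℕ → Set} → Decidable P → ∀ {x} → P x → Least P
least {P} P? {x} = <-rec (λ x → P x → Least P) step x
  where
  step : ∀ x → (∀ {y} → y < x → P y → Least P) → P x → Least P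
  step x rec Px with anyUpTo? P? x
  ... | yes (y , y<x , Py) = rec y<x Py
  ... | no none = x , Px , λ {y} Py → ≮⇒≥ (λ y<x → none (y , y<x , Py))

-- x ≤ y are at cyclic distance at least k in ℤ/nℤ, i.e. adjacent in the circular clique K_{n/k}.
Far : (n k x y : ℕ) → Set
Far n k x y = x + k ≤ y × y + k ≤ x + n

r≤cycDist : ∀ {n r x y} → x + r ≤ y → y + r ≤ x + n → r ≤ cycDist n x y
r≤cycDist {n} {r} {x} {y} x+r≤y y+r≤x+n = ⊓-glb
  (m+n≤o⇒m≤o∸n r (subst (_≤ y) (+-comm x r) x+r≤y))
  (m+n≤o⇒m≤o∸n r (subst (_≤ n) (trans (+-∸-comm r x≤y) (+-comm (y ∸ x) r)) (m≤n+o⇒m∸n≤o (y + r) x y+r≤x+n)))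
  where
  x≤y : x ≤ y
  x≤y = m+n≤o⇒m≤o x x+r≤y

module Rotation (n k r : ℕ) .{{_ : NonZero k}} (1≤r : 1 ≤ r) (rk≤n : r * k ≤ n) where

  corner : ℕ → ℕ → ℕ
  corner x j = (x + j * n) / k

  polygon : ℕ → Vec ℕ k
  polygon x = tabulate (λ j → suc (corner x (toℕ j)))

  lookup-polygon : ∀ x j → lookup (polygon x) j ≡ suc (corner x (toℕ j))
  lookup-polygon x = lookup∘tabulate _

  open ≤-Reasoning

  corner<n : ∀ {x j} → x < n → j < k → corner x j < n
  corner<n {x} {j} x<n j<k = m<n*o⇒m/o<n (begin-strict
    x + j * n  <⟨ +-monoˡ-< (j * n) x<n ⟩
    n + j * n  ≤⟨ *-monoˡ-≤ n j<k ⟩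
    k * n      ≡⟨ *-comm k n ⟩
    n * k      ∎)

  corner-gap : ∀ x {i j} → i < j → corner x i + r ≤ corner x j
  corner-gap x {i} {j} i<j = m+n*k≤o⇒m/k+n≤o/k r k (begin
    x + i * n + r * k  ≤⟨ +-monoʳ-≤ (x + i * n) rk≤n ⟩
    x + i * n + n      ≡⟨ solve (x ∷ i ∷ n ∷ []) ⟩
    x + suc i * n      ≤⟨ +-monoʳ-≤ x (*-monoˡ-≤ n i<j) ⟩
    x + j * n          ∎)

  corner-wrap : ∀ x i {j} → j < k → corner x j + r ≤ corner x i + n
  corner-wrap x i {j} j<k = subst (corner x j + r ≤_) ([m+n*k]/k≡m/k+n (x + i * n) n k)
    (m+n*k≤o⇒m/k+n≤o/k r k (begin
      x + j * n + r * k      ≤⟨ +-monoʳ-≤ (x + j * n) rk≤n ⟩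
      x + j * n + n          ≡⟨ solve (x ∷ j ∷ n ∷ []) ⟩
      x + suc j * n          ≤⟨ +-monoʳ-≤ x (*-monoˡ-≤ n j<k) ⟩
      x + k * n              ≡⟨ solve (x ∷ k ∷ n ∷ []) ⟩
      x + n * k              ≤⟨ +-monoˡ-≤ (n * k) (m≤m+n x (i * n)) ⟩
      x + i * n + n * k      ∎))

  corner-shift : ∀ {x y} i → x + k ≤ y → corner x i < corner y i
  corner-shift {x} {y} i x+k≤y = m+k≤o⇒m/k<o/k k (begin
    x + i * n + k  ≡⟨ solve (x ∷ i ∷ n ∷ k ∷ []) ⟩
    x + k + i * n  ≤⟨ +-monoˡ-≤ (i * n) x+k≤y ⟩
    y + i * n      ∎)

  corner-shift-wrap : ∀ {x y i j} → suc i ≡ j → y + k ≤ x + n → corner y i < corner x j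
  corner-shift-wrap {x} {y} {i} refl y+k≤x+n = ≤-trans (corner-shift i y+k≤x+n)
    (≤-reflexive (cong (_/ k) (solve (x ∷ n ∷ i ∷ []))))

  polygon-isVertex : ∀ {x} → x < n → IsVertex n k r (polygon x)
  polygon-isVertex {x} x<n = (inRange , increasing) , stable
    where
    inRange : ∀ i → 1 ≤ lookup (polygon x) i × lookup (polygon x) i ≤ n
    inRange i rewrite lookup-polygon x i = s≤s z≤n , corner<n x<n (toℕ<n i)
    increasing : ∀ i j → i Data.Fin.< j → lookup (polygon x) i < lookup (polygon x) j
    increasing i j i<j rewrite lookup-polygon x i | lookup-polygon x j =
      s≤s (<-≤-trans (m<m+n _ 1≤r) (corner-gap x i<j))
    stable : IsStable n r k (polygon x)
    stable i j i<j rewrite lookup-polygon x i | lookup-polygon x j =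
      r≤cycDist (corner-gap x i<j) (corner-wrap x (toℕ i) (toℕ<n j))

  polygon-interlace : ∀ {x y} → Far n k x y → Interlace k (polygon x) (polygon y)
  polygon-interlace {x} {y} (x+k≤y , y+k≤x+n) = inj₁ (x-before-y , y-before-x)
    where
    x-before-y : ∀ i → lookup (polygon x) i < lookup (polygon y) i
    x-before-y i rewrite lookup-polygon x i | lookup-polygon y i = s≤s (corner-shift (toℕ i) x+k≤y)
    y-before-x : ∀ i j → suc (toℕ i) ≡ toℕ j → lookup (polygon y) i < lookup (polygon x) j
    y-before-x i j i+1≡j rewrite lookup-polygon y i | lookup-polygon x j =
      s≤s (corner-shift-wrap i+1≡j y+k≤x+n)

module CircularDifference (a : ℕ) .{{_ : NonZero a}} where

  _⊖_ : ℕ → ℕ → ℕ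
  u ⊖ v = (a + u ∸ v) % a

  ⊖<a : ∀ u v → u ⊖ v < a
  ⊖<a u v = m%n<n (a + u ∸ v) a

  ⊖-≤ : ∀ {u v} → v ≤ u → u < a → u ⊖ v ≡ u ∸ v
  ⊖-≤ {u} {v} v≤u u<a = begin
    (a + u ∸ v) % a    ≡⟨ cong (_% a) (trans (+-∸-assoc a v≤u) (+-comm a (u ∸ v))) ⟩
    (u ∸ v + a) % a    ≡⟨ [m+n]%n≡m%n (u ∸ v) a ⟩
    (u ∸ v) % a        ≡⟨ m<n⇒m%n≡m (≤-<-trans (m∸n≤m u v) u<a) ⟩
    u ∸ v              ∎
    where open ≡-Reasoning

  ⊖-< : ∀ {u v} → u < v → u ⊖ v ≡ a + u ∸ v
  ⊖-< {u} {v} u<v = m<n⇒m%n≡m (m<n+o⇒m∸n<o (a + u) v (subst (a + u <_) (+-comm a v) (+-monoʳ-< a u<v)))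

  ⊖-involutive : ∀ {u β} → u < a → β < a → u ⊖ (u ⊖ β) ≡ β
  ⊖-involutive {u} {β} u<a β<a with β ≤? u
  ... | yes β≤u = begin
    u ⊖ (u ⊖ β)    ≡⟨ cong (u ⊖_) (⊖-≤ β≤u u<a) ⟩
    u ⊖ (u ∸ β)    ≡⟨ ⊖-≤ (m∸n≤m u β) u<a ⟩
    u ∸ (u ∸ β)    ≡⟨ m∸[m∸n]≡n β≤u ⟩
    β              ∎
    where open ≡-Reasoning
  ... | no β≰u = begin
    u ⊖ (u ⊖ β)          ≡⟨ cong (u ⊖_) (⊖-< (≰⇒> β≰u)) ⟩
    u ⊖ (a + u ∸ β)      ≡⟨ ⊖-< u<a+u∸β ⟩
    a + u ∸ (a + u ∸ β)  ≡⟨ m∸[m∸n]≡n (≤-trans (<⇒≤ β<a) (m≤m+n a u)) ⟩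
    β                    ∎
    where
    open ≡-Reasoning
    u<a+u∸β : u < a + u ∸ β
    u<a+u∸β = m+n≤o⇒m≤o∸n (suc u) (subst (u + β <_) (+-comm u a) (+-monoʳ-< u β<a))

  ⊖-cocycle : ∀ {u v w} → v ≤ a → w ≤ a → ((u ⊖ v) + (v ⊖ w)) % a ≡ u ⊖ w
  ⊖-cocycle {u} {v} {w} v≤a w≤a = begin
    ((a + u ∸ v) % a + (a + v ∸ w) % a) % a  ≡⟨ sym (%-distribˡ-+ (a + u ∸ v) (a + v ∸ w) a) ⟩
    (a + u ∸ v + (a + v ∸ w)) % a            ≡⟨ cong (_% a) sum ⟩
    (a + u ∸ w + a) % a                      ≡⟨ [m+n]%n≡m%n (a + u ∸ w) a ⟩
    (a + u ∸ w) % a                          ∎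
    where
    open ≡-Reasoning
    interchange : ∀ p q u v → (p + u) + (q + v) ≡ (q + u) + (p + v)
    interchange = solve-∀
    sum : a + u ∸ v + (a + v ∸ w) ≡ a + u ∸ w + a
    sum = begin
      a + u ∸ v + (a + v ∸ w)      ≡⟨ cong₂ _+_ (+-∸-comm u v≤a) (+-∸-comm v w≤a) ⟩
      (a ∸ v + u) + (a ∸ w + v)    ≡⟨ interchange (a ∸ v) (a ∸ w) u v ⟩
      (a ∸ w + u) + (a ∸ v + v)    ≡⟨ cong₂ _+_ (sym (+-∸-comm u w≤a)) (m∸n+n≡m v≤a) ⟩
      a + u ∸ w + a                ∎

  -- (u ⊖ v) + (v ⊖ w) is u ⊖ w or u ⊖ w + a; the first is too small and the second too large
  -- for a difference u ⊖ v in [b, a ∸ b].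
  same-arc⇒not-separated : ∀ {b u v w} → v ≤ a → w ≤ a → u ⊖ w < b → v ⊖ w < b →
                           ¬ (b ≤ u ⊖ v × u ⊖ v ≤ a ∸ b)
  same-arc⇒not-separated {b} {u} {v} {w} v≤a w≤a u∈arc v∈arc (b≤u⊖v , u⊖v≤a∸b)
    with m<n+n⇒m%n≡m⊎m%n+n≡m a (+-mono-< (⊖<a u v) (⊖<a v w))
  ... | inj₁ no-wrap = <⇒≱ u∈arc (begin
    b                          ≤⟨ b≤u⊖v ⟩
    u ⊖ v                      ≤⟨ m≤m+n (u ⊖ v) (v ⊖ w) ⟩
    (u ⊖ v) + (v ⊖ w)          ≡⟨ sym no-wrap ⟩
    ((u ⊖ v) + (v ⊖ w)) % a    ≡⟨ ⊖-cocycle v≤a w≤a ⟩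
    u ⊖ w                      ∎)
    where open ≤-Reasoning
  ... | inj₂ wrap = <-irrefl refl (begin-strict
    (u ⊖ v) + b                     ≤⟨ m≤o∸n⇒m+n≤o (u ⊖ v) (≤-trans b≤u⊖v (<⇒≤ (⊖<a u v))) u⊖v≤a∸b ⟩
    a                               ≤⟨ m≤n+m a (u ⊖ w) ⟩
    u ⊖ w + a                       ≡⟨ cong (_+ a) (sym (⊖-cocycle v≤a w≤a)) ⟩
    ((u ⊖ v) + (v ⊖ w)) % a + a     ≡⟨ wrap ⟩
    (u ⊖ v) + (v ⊖ w)               <⟨ +-monoʳ-< (u ⊖ v) v∈arc ⟩
    (u ⊖ v) + b                     ∎)
    where open ≤-Reasoning

record Ranking (n k : ℕ) (S : ℕ → Set) : Set where
  field
    rank           : ℕ → ℕ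
    rank<k         : ∀ {x} → x < n → S x → rank x < k
    rank-injective : ∀ {x y} → x < n → y < n → S x → S y → rank x ≡ rank y → x ≡ y

module _ {n k : ℕ} .{{_ : NonZero k}} (k+k≤n : k + k ≤ n) where

  y+k≡x+n⇒Far : ∀ {x y} → y + k ≡ x + n → Far n k x y
  y+k≡x+n⇒Far {x} {y} y+k≡x+n = +-cancelʳ-≤ k (x + k) y (begin
    x + k + k    ≡⟨ +-assoc x k k ⟩
    x + (k + k)  ≤⟨ +-monoʳ-≤ x k+k≤n ⟩
    x + n        ≡⟨ sym y+k≡x+n ⟩
    y + k        ∎) , ≤-reflexive y+k≡x+n
    where open ≤-Reasoning

  module _ {S : ℕ → Set} (independent : ∀ {x y} → x < n → y < n → S x → S y → ¬ Far n k x y) where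

    private module Anchored (s : ℕ) (s<n : s < n) (Ss : S s) (s-least : ∀ {y} → S y → s ≤ y) where

      rank : ℕ → ℕ
      rank x with x <? s + k
      ... | yes _ = x ∸ s
      ... | no _  = x + k ∸ (s + n)

      wraps : ∀ {x} → x < n → S x → ¬ x < s + k → s + n < x + k
      wraps x<n Sx x≮s+k = ≰⇒> (λ x+k≤s+n → independent s<n x<n Ss Sx (≮⇒≥ x≮s+k , x+k≤s+n))

      rank<k : ∀ {x} → x < n → S x → rank x < k
      rank<k {x} x<n Sx with x <? s + k
      ... | yes x<s+k = m<n+o⇒m∸n<o x s x<s+k
      ... | no _      = m<n+o⇒m∸n<o (x + k) (s + n) (+-monoˡ-< k (<-≤-trans x<n (m≤n+m n s)))

      crossing : ∀ {x y} → S x → s + n < y + k → x ∸ s ≡ y + k ∸ (s + n) → Far n k x y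
      crossing {x} {y} Sx wrap eq = y+k≡x+n⇒Far (begin
        y + k                     ≡⟨ sym (m∸n+n≡m (<⇒≤ wrap)) ⟩
        y + k ∸ (s + n) + (s + n) ≡⟨ cong (_+ (s + n)) (sym eq) ⟩
        x ∸ s + (s + n)           ≡⟨ sym (+-assoc (x ∸ s) s n) ⟩
        x ∸ s + s + n             ≡⟨ cong (_+ n) (m∸n+n≡m (s-least Sx)) ⟩
        x + n                     ∎)
        where open ≡-Reasoning

      rank-injective : ∀ {x y} → x < n → y < n → S x → S y → rank x ≡ rank y → x ≡ y
      rank-injective {x} {y} x<n y<n Sx Sy eq with x <? s + k | y <? s + k
      ... | yes _     | yes _     = ∸-cancelʳ-≡ (s-least Sx) (s-least Sy) eq
      ... | no x≮s+k  | no y≮s+k  = +-cancelʳ-≡ k x y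
        (∸-cancelʳ-≡ (<⇒≤ (wraps x<n Sx x≮s+k)) (<⇒≤ (wraps y<n Sy y≮s+k)) eq)
      ... | yes _     | no y≮s+k  = ⊥-elim (independent x<n y<n Sx Sy (crossing Sx (wraps y<n Sy y≮s+k) eq))
      ... | no x≮s+k  | yes _     = ⊥-elim (independent y<n x<n Sy Sx (crossing Sy (wraps x<n Sx x≮s+k) (sym eq)))

    independent-ranking : Decidable S → Ranking n k S
    independent-ranking S? with anyUpTo? S? n
    ... | no empty = record
      { rank = λ _ → 0
      ; rank<k = λ x<n Sx → ⊥-elim (empty (_ , x<n , Sx))
      ; rank-injective = λ x<n _ Sx _ _ → ⊥-elim (empty (_ , x<n , Sx))
      }
    ... | yes (x , x<n , Sx) with least S? Sx
    ...   | s , Ss , s-least = record { Anchored s (≤-<-trans (s-least Sx) x<n) Ss s-least }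

module Coloring {n k r a b : ℕ} .{{_ : NonZero k}} .{{_ : NonZero a}}
  (1≤r : 1 ≤ r) (rk≤n : r * k ≤ n) (k+k≤n : k + k ≤ n)
  (χ : Vec ℕ k → Fin a) (coloring : IsCircularColoring n k r a b χ) where

  open Rotation n k r 1≤r rk≤n
  open CircularDifference a

  color : ℕ → ℕ
  color x = toℕ (χ (polygon x))

  InArc : Fin a → ℕ → Set
  InArc c x = color x ⊖ toℕ c < b

  separated : ∀ {x y} → x < n → y < n → Far n k x y →
              b ≤ color x ⊖ color y × color x ⊖ color y ≤ a ∸ b
  separated x<n y<n far =
    coloring _ _ (polygon-isVertex x<n) (polygon-isVertex y<n) (polygon-interlace far)

  arc-independent : ∀ c {x y} → x < n → y < n → InArc c x → InArc c y → ¬ Far n k x y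
  arc-independent c x<n y<n x∈c y∈c far =
    same-arc⇒not-separated (<⇒≤ (toℕ<n (χ _))) (<⇒≤ (toℕ<n c)) x∈c y∈c (separated x<n y<n far)

  b≤a : b ≤ a
  b≤a = ≤-trans (proj₁ (separated (≤-<-trans z≤n k<n) k<n (≤-refl , k+k≤n))) (<⇒≤ (⊖<a (color 0) (color k)))
    where
    k<n : k < n
    k<n = <-≤-trans (m<m+n k (>-nonZero⁻¹ k)) k+k≤n

  ranking : ∀ c → Ranking n k (InArc c)
  ranking c = independent-ranking k+k≤n (arc-independent c) (λ x → color x ⊖ toℕ c <? b)

  open Ranking

  rank-injective′ : ∀ {c c′ x y} → c ≡ c′ → x < n → y < n → InArc c x → InArc c′ y →
                    rank (ranking c) x ≡ rank (ranking c′) y → x ≡ y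
  rank-injective′ {c} refl = rank-injective (ranking c)

  arc : Fin n → Fin b → Fin a
  arc i β = fromℕ< (⊖<a (color (toℕ i)) (toℕ β))

  offset : ∀ i β → color (toℕ i) ⊖ toℕ (arc i β) ≡ toℕ β
  offset i β = trans (cong (color (toℕ i) ⊖_) (toℕ-fromℕ< (⊖<a (color (toℕ i)) (toℕ β))))
                     (⊖-involutive (toℕ<n (χ (polygon (toℕ i)))) (<-≤-trans (toℕ<n β) b≤a))

  in-arc : ∀ i β → InArc (arc i β) (toℕ i)
  in-arc i β = subst (_< b) (sym (offset i β)) (toℕ<n β)

  encode : Fin n × Fin b → Fin a × Fin k
  encode (i , β) = arc i β , fromℕ< (rank<k (ranking (arc i β)) (toℕ<n i) (in-arc i β))

  encode-injective : Injective _≡_ _≡_ encode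
  encode-injective {i , β} {i′ , β′} eq = cong₂ _,_ i≡i′ (toℕ-injective (begin
    toℕ β                             ≡⟨ sym (offset i β) ⟩
    color (toℕ i) ⊖ toℕ (arc i β)     ≡⟨ cong₂ (λ j c → color (toℕ j) ⊖ toℕ c) i≡i′ same-arc ⟩
    color (toℕ i′) ⊖ toℕ (arc i′ β′)  ≡⟨ offset i′ β′ ⟩
    toℕ β′                            ∎))
    where
    open ≡-Reasoning
    same-arc : arc i β ≡ arc i′ β′
    same-arc = proj₁ (,-injective eq)
    i≡i′ : i ≡ i′
    i≡i′ = toℕ-injective (rank-injective′ same-arc (toℕ<n i) (toℕ<n i′) (in-arc i β) (in-arc i′ β′)
      (fromℕ<-injective _ _ _ _ (proj₂ (,-injective eq))))

lemma6 : (n k r : ℕ) → 1 ≤ k → 2 ≤ r → r * k ≤ n →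
         (a b : ℕ) .{{_ : NonZero a}} → 1 ≤ b →
         (χ : Vec ℕ k → Fin a) → IsCircularColoring n k r a b χ →
         n * b ≤ a * k
lemma6 n zero    r () _ _ _ _ _ _ _
lemma6 n (suc k) r _ 2≤r rk≤n a b _ χ coloring =
  injective⇒≤ (Injection.injective (↔⇒↣ (↔-sym *↔×) ↣-∘ (mk↣ encode-injective ↣-∘ ↔⇒↣ *↔×)))
  where
  k+k≤n : suc k + suc k ≤ n
  k+k≤n = ≤-trans (≤-reflexive (cong (suc k +_) (sym (+-identityʳ (suc k)))))
                  (≤-trans (*-monoˡ-≤ (suc k) 2≤r) rk≤n)
  open Coloring (<⇒≤ 2≤r) rk≤n k+k≤n χ coloring
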